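{- Let $n \geq 1$ and let $\mathcal F \subset 2^{[n]}$ satisfy $\emptyset \in \mathcal F$ and $[n] \notin \mathcal F$. Then $\|\partial \mathcal F\|_n \geq 1$, and the inequality is strict unless $\mathcal F = \{F \subset [n] : |F| \leq j\}$ for some $0 \leq j < n$.
   Context: $[n]=\{1,\dots,n\}$. For $\mathcal F \subset 2^{[n]}$ the binomial norm is $\|\mathcal F\|_n = \sum_{F \in \mathcal F} 1\big/\binom{n}{|F|}$. The outer boundary of $\mathcal F$ is $\partial \mathcal F = \{G \subset [n] : G \notin \mathcal F,\ \exists F \in \mathcal F \text{ with } |F \triangle G| = 1\}$, where $\triangle$ is symmetric difference. -}

module Defs where

open import Data.Bool using (Bool; true; false; _∧_; not; if_then_else_)
open import Data.Nat using (ℕ; zero; suc; _≡ᵇ_)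
open import Data.Nat.Combinatorics using (_C_)
open import Data.Fin.Subset using (Subset; _∪_; _─_; ∣_∣; inside; outside)
open import Data.List using (List; []; _∷_; map; _++_; foldr; filter)
open import Data.Bool.ListAction using (any)
open import Data.Vec using (_∷_; [])
open import Data.Integer using (+_)
open import Data.Rational using (ℚ; 0ℚ; _+_; _/_)

allSubsets : (n : ℕ) → List (Subset n)
allSubsets zero = [] ∷ []
allSubsets (suc n) = map (inside ∷_) (allSubsets n) ++ map (outside ∷_) (allSubsets n)

Family : ℕ → Set
Family n = Subset n → Bool

_△_ : ∀ {n} → Subset n → Subset n → Subset n
F △ G = (F ─ G) ∪ (G ─ F)

boundary : ∀ {n} → Family n → Family n
boundary {n} 𝓕 G = not (𝓕 G) ∧ any (λ F → 𝓕 F ∧ (∣ F △ G ∣ ≡ᵇ 1)) (allSubsets n)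

-- 1 / m as a rational (m is always a binomial coefficient C(n,k) with k ≤ n, hence ≥ 1;
-- the value at 0 is an irrelevant convention).
recip : ℕ → ℚ
recip zero = 0ℚ
recip (suc m) = + 1 / suc m

norm : ∀ {n} → Family n → ℚ
norm {n} 𝓕 = foldr (λ F acc → (if 𝓕 F then recip (n C ∣ F ∣) else 0ℚ) + acc) 0ℚ (allSubsets n)

-- Double counting over maximal chains ∅ = C₀ ⋖ C₁ ⋖ ⋯ ⋖ Cₙ = [n]. A set G lies on
-- |G|! (n − |G|)! = n! / C(n, |G|) of the n! maximal chains, so n! ‖∂𝓕‖ₙ counts the pairs
-- (chain, boundary set on it). Every chain starts in 𝓕 and ends outside it, so at its first
-- exit it meets ∂𝓕; hence ‖∂𝓕‖ₙ ≥ 1. If equality holds, every chain meets ∂𝓕 exactly once.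
-- Then 𝓕 is down-closed (a chain through G ⋖ H with G ∉ 𝓕, H ∈ 𝓕 would exit 𝓕 twice), and
-- in every square D ⋖ G, G′ ⋖ U, G ∈ 𝓕 forces G′ ∈ 𝓕 (else the chain through D, G′, U meets
-- ∂𝓕 at both G′ and U).
-- Such exchanges connect each level of the cube, so 𝓕 is a union of levels, i.e. a ball.

module Submission where

open import Defs
open import Data.Bool using (Bool; true; false; not; _∧_; if_then_else_; T)
open import Data.Bool.Properties using (T-≡; ¬-not)
open import Data.Nat using (ℕ; zero; suc; _≤ᵇ_; _+_; _*_; _∸_; _!; _≡ᵇ_; z≤n; s≤s; pred; _≤?_)
  renaming (_≤_ to _≤ℕ_; _<_ to _<ℕ_)
open import Data.Nat.Properties
open import Relation.Binary using (tri<; tri≈; tri>)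
open import Data.Nat.Tactic.RingSolver using (solve-∀)
open import Algebra.Properties.CommutativeSemigroup +-commutativeSemigroup using (interchange)
open import Data.Fin.Subset using (Subset; ⊥; ⊤; ∣_∣; inside; outside)
open import Data.Fin.Subset.Properties using (∣⊥∣≡0; ∣p∣≤n)
open import Data.Vec using (_∷_; [])
open import Data.Unit using (tt)
open import Data.Empty using (⊥-elim) renaming (⊥ to Empty)
open import Data.List using (List; []; _∷_; _++_; map; concatMap; applyUpTo; foldr)
open import Data.List.Membership.Propositional using (_∈_; find; lose)
open import Data.List.Membership.Propositional.Properties
  using (∈-++⁺ˡ; ∈-++⁺ʳ; ∈-map⁺; ∈-concatMap⁺; ∈-concatMap⁻; ∈-applyUpTo⁺; ∈-applyUpTo⁻)
open import Data.List.Relation.Unary.Any using (here; there)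
open import Data.List.Relation.Unary.Any.Properties using (any⁺)
open import Data.List.Relation.Unary.All as All using (all?)
open import Data.List.Relation.Unary.All.Properties using (¬All⇒Any¬)
open import Data.Product using (Σ; ∃; _×_; _,_)
open import Data.Sum using (inj₁; inj₂)
open import Function using (Equivalence; _∘_)
open import Data.Nat.Combinatorics using (_C_; nCk≡n!/k![n-k]!; k![n∸k]!∣n!)
open import Data.Nat.DivMod using (m/n*n≡m)
open import Data.Integer using (1ℤ)
import Data.Integer as ℤ
import Data.Integer.Properties as ℤ
open import Data.Integer.Tactic.RingSolver using () renaming (solve-∀ to ℤ-solve-∀)
open import Data.Rational using (ℚ; 0ℚ; 1ℚ; _≤_; _<_; toℚᵘ)
import Data.Rational as ℚ
open import Data.Rational.Properties
  using (toℚᵘ-homo-+; toℚᵘ-fromℚᵘ; toℚᵘ-cancel-≤; toℚᵘ-cancel-<)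
open import Data.Rational.Unnormalised using (ℚᵘ; mkℚᵘ; *≡*; *≤*; *<*)
import Data.Rational.Unnormalised as ℚᵘ
import Data.Rational.Unnormalised.Properties as ℚᵘ
open import Relation.Binary.PropositionalEquality
open import Relation.Nullary using (¬_; yes; no; contradiction)

private
  variable
    A B : Set

⟦_⟧ : Bool → ℕ
⟦ true ⟧ = 1
⟦ false ⟧ = 0

≤⇒≤ᵇ≡true : ∀ {i j} → i ≤ℕ j → (i ≤ᵇ j) ≡ true
≤⇒≤ᵇ≡true i≤j = Equivalence.to T-≡ (≤⇒≤ᵇ i≤j)

>⇒≤ᵇ≡false : ∀ {i j} → j <ℕ i → (i ≤ᵇ j) ≡ false
>⇒≤ᵇ≡false {i} {j} j<i = ¬-not (λ e → <⇒≱ j<i (≤ᵇ⇒≤ i j (Equivalence.from T-≡ e)))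

true≢false : ∀ {b} → b ≡ true → b ≢ false
true≢false refl ()

∑< : ℕ → (ℕ → ℕ) → ℕ
∑< zero f = 0
∑< (suc m) f = ∑< m f + f m

syntax ∑< m (λ i → e) = ∑[ i < m ] e

∑<-cong : ∀ m {f g : ℕ → ℕ} → (∀ i → i <ℕ m → f i ≡ g i) → ∑< m f ≡ ∑< m g
∑<-cong zero f≗g = refl
∑<-cong (suc m) f≗g = cong₂ _+_ (∑<-cong m (λ i i<m → f≗g i (m<n⇒m<1+n i<m))) (f≗g m ≤-refl)

∑<-distrib-+ : ∀ m (f g : ℕ → ℕ) → ∑[ i < m ] (f i + g i) ≡ ∑< m f + ∑< m g
∑<-distrib-+ zero f g = refl
∑<-distrib-+ (suc m) f g
  rewrite ∑<-distrib-+ m f g = interchange (∑< m f) (∑< m g) (f m) (g m)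

∑<-comm : ∀ m k (g : ℕ → ℕ → ℕ) → ∑[ i < m ] ∑< k (g i) ≡ ∑[ j < k ] ∑[ i < m ] g i j
∑<-comm zero k g = sym (∑<-zero k)
  where
  ∑<-zero : ∀ k → ∑[ _ < k ] 0 ≡ 0
  ∑<-zero zero = refl
  ∑<-zero (suc k) = trans (+-identityʳ _) (∑<-zero k)
∑<-comm (suc m) k g
  rewrite ∑<-comm m k g = sym (∑<-distrib-+ k (λ j → ∑[ i < m ] g i j) (g m))

∑<-*ʳ : ∀ m (f : ℕ → ℕ) a → ∑[ i < m ] (f i * a) ≡ ∑< m f * a
∑<-*ʳ zero f a = refl
∑<-*ʳ (suc m) f a rewrite ∑<-*ʳ m f a = sym (*-distribʳ-+ a (∑< m f) (f m))

∑<-suc : ∀ m (f : ℕ → ℕ) → ∑< (suc m) f ≡ f 0 + ∑[ i < m ] f (suc i)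
∑<-suc zero f = sym (+-identityʳ (f 0))
∑<-suc (suc m) f rewrite ∑<-suc m f = +-assoc (f 0) _ _

count : ℕ → (ℕ → Bool) → ℕ
count m p = ∑[ i < m ] ⟦ p i ⟧

count-≥ : ∀ j m → count m (j ≤ᵇ_) ≡ m ∸ j
count-≥ j zero = sym (0∸n≡0 j)
count-≥ j (suc m) with j ≤? m
... | yes j≤m rewrite count-≥ j m | ≤⇒≤ᵇ≡true j≤m =
  trans (+-comm (m ∸ j) 1) (sym (+-∸-assoc 1 j≤m))
... | no j≰m rewrite count-≥ j m | >⇒≤ᵇ≡false (≰⇒> j≰m) =
  trans (+-identityʳ (m ∸ j))
        (trans (m≤n⇒m∸n≡0 (<⇒≤ (≰⇒> j≰m))) (sym (m≤n⇒m∸n≡0 (≰⇒> j≰m))))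

count-≤-all : ∀ j m → m ≤ℕ suc j → count m (_≤ᵇ j) ≡ m
count-≤-all j zero _ = refl
count-≤-all j (suc m) m<1+j
  rewrite count-≤-all j m (<⇒≤ m<1+j) | ≤⇒≤ᵇ≡true (≤-pred m<1+j) = +-comm m 1

count-≤ : ∀ j m → j <ℕ m → count m (_≤ᵇ j) ≡ suc j
count-≤ j (suc m) j<1+m with m≤n⇒m<n∨m≡n (≤-pred j<1+m)
... | inj₁ j<m rewrite count-≤ j m j<m | >⇒≤ᵇ≡false j<m = +-identityʳ (suc j)
... | inj₂ refl = count-≤-all j (suc j) ≤-refl

count-≥1 : ∀ m (p : ℕ → Bool) {k} → k <ℕ m → p k ≡ true → 1 ≤ℕ count m p
count-≥1 (suc m) p k<1+m pk with m≤n⇒m<n∨m≡n (≤-pred k<1+m)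
... | inj₁ k<m = ≤-trans (count-≥1 m p k<m pk) (m≤m+n _ _)
... | inj₂ refl rewrite pk = m≤n+m 1 _

count-≥2 : ∀ m (p : ℕ → Bool) {k l} → k <ℕ l → l <ℕ m →
           p k ≡ true → p l ≡ true → 2 ≤ℕ count m p
count-≥2 (suc m) p k<l l<1+m pk pl with m≤n⇒m<n∨m≡n (≤-pred l<1+m)
... | inj₁ l<m = ≤-trans (count-≥2 m p k<l l<m pk pl) (m≤m+n _ _)
... | inj₂ refl rewrite pl = +-monoˡ-≤ 1 (count-≥1 _ p k<l pk)

∑∈ : List A → (A → ℕ) → ℕ
∑∈ [] f = 0
∑∈ (x ∷ xs) f = f x + ∑∈ xs f

syntax ∑∈ xs (λ x → e) = ∑[ x ← xs ] e

∑∈-cong : (xs : List A) {f g : A → ℕ} → (∀ {x} → x ∈ xs → f x ≡ g x) → ∑∈ xs f ≡ ∑∈ xs g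
∑∈-cong [] f≗g = refl
∑∈-cong (x ∷ xs) f≗g = cong₂ _+_ (f≗g (here refl)) (∑∈-cong xs (f≗g ∘ there))

∑∈-mono-≤ : (xs : List A) {f g : A → ℕ} → (∀ {x} → x ∈ xs → f x ≤ℕ g x) →
            ∑∈ xs f ≤ℕ ∑∈ xs g
∑∈-mono-≤ [] f≤g = z≤n
∑∈-mono-≤ (x ∷ xs) f≤g = +-mono-≤ (f≤g (here refl)) (∑∈-mono-≤ xs (f≤g ∘ there))

∑∈-mono-< : (xs : List A) {f g : A → ℕ} → (∀ {x} → x ∈ xs → f x ≤ℕ g x) →
            ∀ {y} → y ∈ xs → f y <ℕ g y → ∑∈ xs f <ℕ ∑∈ xs g
∑∈-mono-< (x ∷ xs) f≤g (here refl) fy<gy = +-mono-<-≤ fy<gy (∑∈-mono-≤ xs (f≤g ∘ there))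
∑∈-mono-< (x ∷ xs) f≤g (there y∈xs) fy<gy =
  +-mono-≤-< (f≤g (here refl)) (∑∈-mono-< xs (f≤g ∘ there) y∈xs fy<gy)

∑∈-distrib-+ : (xs : List A) (f g : A → ℕ) → ∑[ x ← xs ] (f x + g x) ≡ ∑∈ xs f + ∑∈ xs g
∑∈-distrib-+ [] f g = refl
∑∈-distrib-+ (x ∷ xs) f g rewrite ∑∈-distrib-+ xs f g = interchange (f x) (g x) (∑∈ xs f) (∑∈ xs g)

∑∈-++ : (xs ys : List A) (f : A → ℕ) → ∑∈ (xs ++ ys) f ≡ ∑∈ xs f + ∑∈ ys f
∑∈-++ [] ys f = refl
∑∈-++ (x ∷ xs) ys f rewrite ∑∈-++ xs ys f = sym (+-assoc (f x) _ _)

∑∈-const : (xs : List A) (a : ℕ) → ∑[ _ ← xs ] a ≡ ∑∈ xs (λ _ → 1) * a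
∑∈-const [] a = refl
∑∈-const (x ∷ xs) a rewrite ∑∈-const xs a = refl

∑∈-map : (h : A → B) (xs : List A) (f : B → ℕ) → ∑∈ (map h xs) f ≡ ∑[ x ← xs ] f (h x)
∑∈-map h [] f = refl
∑∈-map h (x ∷ xs) f rewrite ∑∈-map h xs f = refl

∑∈-concatMap : (g : A → List B) (xs : List A) (f : B → ℕ) →
               ∑∈ (concatMap g xs) f ≡ ∑[ x ← xs ] ∑∈ (g x) f
∑∈-concatMap g [] f = refl
∑∈-concatMap g (x ∷ xs) f rewrite ∑∈-++ (g x) (concatMap g xs) f | ∑∈-concatMap g xs f = refl

∑∈-applyUpTo : (g : ℕ → A) (m : ℕ) (f : A → ℕ) → ∑∈ (applyUpTo g m) f ≡ ∑[ i < m ] f (g i)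
∑∈-applyUpTo g zero f = refl
∑∈-applyUpTo g (suc m) f = begin
  f (g 0) + ∑∈ (applyUpTo (g ∘ suc) m) f  ≡⟨ cong (f (g 0) +_) (∑∈-applyUpTo (g ∘ suc) m f) ⟩
  f (g 0) + ∑[ i < m ] f (g (suc i))      ≡⟨ ∑<-suc m (f ∘ g) ⟨
  ∑[ i < suc m ] f (g i)                  ∎
  where open ≡-Reasoning

data _⋖_ : ∀ {n} → Subset n → Subset n → Set where
  ⋖-head : ∀ {n} {p : Subset n} → (outside ∷ p) ⋖ (inside ∷ p)
  ⋖-tail : ∀ {n b} {p q : Subset n} → p ⋖ q → (b ∷ p) ⋖ (b ∷ q)

⋖⇒∣∣≡suc : ∀ {n} {p q : Subset n} → p ⋖ q → ∣ q ∣ ≡ suc ∣ p ∣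
⋖⇒∣∣≡suc ⋖-head = refl
⋖⇒∣∣≡suc (⋖-tail {b = inside} p⋖q) = cong suc (⋖⇒∣∣≡suc p⋖q)
⋖⇒∣∣≡suc (⋖-tail {b = outside} p⋖q) = ⋖⇒∣∣≡suc p⋖q

-- Only the sets c 0, …, c n of a chain c : Chain n matter.
Chain : ℕ → Set
Chain n = ℕ → Subset n

record IsMaximalChain {n} (c : Chain n) : Set where
  field
    starts-empty : c 0 ≡ ⊥
    ends-full : c n ≡ ⊤
    covers : ∀ {j} → j <ℕ n → c j ⋖ c (suc j)

open IsMaximalChain

IsMaximalChain⇒∣c∣≡ : ∀ {n} {c : Chain n} → IsMaximalChain c →
                      ∀ {j} → j ≤ℕ n → ∣ c j ∣ ≡ j
IsMaximalChain⇒∣c∣≡ {n} c-max {zero} _ = trans (cong ∣_∣ (starts-empty c-max)) (∣⊥∣≡0 n)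
IsMaximalChain⇒∣c∣≡ c-max {suc j} j<n =
  trans (⋖⇒∣∣≡suc (covers c-max j<n)) (cong suc (IsMaximalChain⇒∣c∣≡ c-max (<⇒≤ j<n)))

-- Coordinate 0 joins the chain D right after step i.
insert : ∀ {n} → ℕ → Chain n → Chain (suc n)
insert i D zero = outside ∷ D zero
insert zero D (suc j) = inside ∷ D j
insert (suc i) D (suc j) = insert i (D ∘ suc) j

insert-before : ∀ {n} (D : Chain n) {i j} → j ≤ℕ i → insert i D j ≡ outside ∷ D j
insert-before D {j = zero} _ = refl
insert-before D {suc i} {suc j} (s≤s j≤i) = insert-before (D ∘ suc) j≤i

insert-after : ∀ {n} (D : Chain n) {i j} → i ≤ℕ j → insert i D (suc j) ≡ inside ∷ D j
insert-after D {zero} _ = refl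
insert-after D {suc i} {suc j} (s≤s i≤j) = insert-after (D ∘ suc) i≤j

insert-isMaximalChain : ∀ {n} {D : Chain n} → IsMaximalChain D →
                        ∀ {i} → i ≤ℕ n → IsMaximalChain (insert i D)
starts-empty (insert-isMaximalChain D-max _) = cong (outside ∷_) (starts-empty D-max)
ends-full (insert-isMaximalChain {n} {D} D-max i≤n) =
  trans (insert-after D i≤n) (cong (inside ∷_) (ends-full D-max))
covers (insert-isMaximalChain {n} {D} D-max {i} i≤n) {j} j<1+n with <-cmp j i
... | tri< j<i _ _ = subst₂ _⋖_ (sym (insert-before D (<⇒≤ j<i))) (sym (insert-before D j<i))
                               (⋖-tail (covers D-max (≤-trans j<i i≤n)))
... | tri≈ _ refl _ =
  subst₂ _⋖_ (sym (insert-before D (≤-refl {i}))) (sym (insert-after D (≤-refl {i}))) ⋖-head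
covers (insert-isMaximalChain {n} {D} D-max {i} i≤n) {suc j} 2+j≤1+n | tri> _ _ (s≤s i≤j) =
  subst₂ _⋖_ (sym (insert-after D i≤j)) (sym (insert-after D (m≤n⇒m≤1+n i≤j)))
             (⋖-tail (covers D-max (≤-pred 2+j≤1+n)))

insertions : ∀ {n} → Chain n → List (Chain (suc n))
insertions {n} D = applyUpTo (λ i → insert i D) (suc n)

maximalChains : (n : ℕ) → List (Chain n)
maximalChains zero = (λ _ → []) ∷ []
maximalChains (suc n) = concatMap insertions (maximalChains n)

insert-∈ : ∀ {n} {D : Chain n} → D ∈ maximalChains n →
           ∀ {i} → i ≤ℕ n → insert i D ∈ maximalChains (suc n)
insert-∈ {D = D} D∈ i≤n =
  ∈-concatMap⁺ insertions (lose D∈ (∈-applyUpTo⁺ (λ i → insert i D) (s≤s i≤n)))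

∈-maximalChains⇒isMaximalChain : ∀ n {c : Chain n} → c ∈ maximalChains n → IsMaximalChain c
∈-maximalChains⇒isMaximalChain zero (here refl) =
  record { starts-empty = refl ; ends-full = refl ; covers = λ () }
∈-maximalChains⇒isMaximalChain (suc n) c∈
  with D , D∈ , c∈insertions ← find (∈-concatMap⁻ insertions {xs = maximalChains n} c∈)
  with i , i<1+n , refl ← ∈-applyUpTo⁻ (λ i → insert i D) c∈insertions
  = insert-isMaximalChain (∈-maximalChains⇒isMaximalChain n D∈) (≤-pred i<1+n)

chain-through : ∀ n (G : Subset n) → ∃ λ c → c ∈ maximalChains n × c ∣ G ∣ ≡ G
chain-through zero [] = (λ _ → []) , here refl , refl
chain-through (suc n) (outside ∷ p) with D , D∈ , D∣p∣≡p ← chain-through n p =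
  insert n D , insert-∈ D∈ ≤-refl , trans (insert-before D (∣p∣≤n p)) (cong (outside ∷_) D∣p∣≡p)
chain-through (suc n) (inside ∷ p) with D , D∈ , D∣p∣≡p ← chain-through n p =
  insert 0 D , insert-∈ D∈ z≤n , cong (inside ∷_) D∣p∣≡p

⋖⇒∣∣<n : ∀ {n} {G H : Subset n} → G ⋖ H → ∣ G ∣ <ℕ n
⋖⇒∣∣<n {n} {H = H} G⋖H = subst (_≤ℕ n) (⋖⇒∣∣≡suc G⋖H) (∣p∣≤n H)

chain-through-⋖ : ∀ {n} {G H : Subset n} → G ⋖ H →
                  ∃ λ c → c ∈ maximalChains n × c ∣ G ∣ ≡ G × c (suc ∣ G ∣) ≡ H
chain-through-⋖ {suc n} (⋖-head {p = p}) with D , D∈ , D∣p∣≡p ← chain-through n p =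
  insert ∣ p ∣ D , insert-∈ D∈ (∣p∣≤n p) ,
  trans (insert-before D ≤-refl) (cong (outside ∷_) D∣p∣≡p) ,
  trans (insert-after D ≤-refl) (cong (inside ∷_) D∣p∣≡p)
chain-through-⋖ {suc n} (⋖-tail {b = outside} p⋖q) with D , D∈ , Dp , Dq ← chain-through-⋖ p⋖q =
  insert n D , insert-∈ D∈ ≤-refl ,
  trans (insert-before D (<⇒≤ (⋖⇒∣∣<n p⋖q))) (cong (outside ∷_) Dp) ,
  trans (insert-before D (⋖⇒∣∣<n p⋖q)) (cong (outside ∷_) Dq)
chain-through-⋖ {suc n} (⋖-tail {b = inside} p⋖q) with D , D∈ , Dp , Dq ← chain-through-⋖ p⋖q =
  insert 0 D , insert-∈ D∈ z≤n , cong (inside ∷_) Dp , cong (inside ∷_) Dq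

∑-insert : ∀ {n} (D : Chain n) (f : Subset (suc n) → ℕ) {i} → i ≤ℕ n →
           ∑[ j < suc (suc n) ] f (insert i D j) ≡
           ∑[ j < suc n ] (⟦ j ≤ᵇ i ⟧ * f (outside ∷ D j) + ⟦ i ≤ᵇ j ⟧ * f (inside ∷ D j))
∑-insert {n} D f {i} i≤n = begin
  ∑[ j < suc (suc n) ] f (insert i D j)                ≡⟨ ∑<-cong (suc (suc n)) (λ j _ → split j) ⟩
  ∑[ j < suc (suc n) ] (before j + after j)            ≡⟨ ∑<-distrib-+ (suc (suc n)) before after ⟩
  ∑< (suc (suc n)) before + ∑< (suc (suc n)) after
    ≡⟨ cong₂ _+_ last-before-vanishes (∑<-suc (suc n) after) ⟩
  ∑< (suc n) before + ∑[ j < suc n ] after (suc j)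
    ≡⟨ cong (∑< (suc n) before +_) (∑<-cong (suc n) (λ j _ → after-suc j)) ⟩
  ∑< (suc n) before + ∑[ j < suc n ] (⟦ i ≤ᵇ j ⟧ * f (inside ∷ D j))
    ≡⟨ ∑<-distrib-+ (suc n) before (λ j → ⟦ i ≤ᵇ j ⟧ * f (inside ∷ D j)) ⟨
  ∑[ j < suc n ] (⟦ j ≤ᵇ i ⟧ * f (outside ∷ D j) + ⟦ i ≤ᵇ j ⟧ * f (inside ∷ D j)) ∎
  where
  open ≡-Reasoning
  before after : ℕ → ℕ
  before j = ⟦ j ≤ᵇ i ⟧ * f (outside ∷ D j)
  after j = ⟦ not (j ≤ᵇ i) ⟧ * f (inside ∷ D (pred j))
  split : ∀ j → f (insert i D j) ≡ before j + after j
  split j with j ≤? i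
  ... | yes j≤i rewrite insert-before D j≤i | ≤⇒≤ᵇ≡true j≤i =
    sym (trans (+-identityʳ _) (*-identityˡ _))
  split zero | no 0≰i = contradiction z≤n 0≰i
  split (suc j) | no 1+j≰i
    rewrite insert-after D (≤-pred (≰⇒> 1+j≰i)) | >⇒≤ᵇ≡false (≰⇒> 1+j≰i) =
    sym (*-identityˡ _)
  last-before-vanishes : ∑< (suc (suc n)) before ≡ ∑< (suc n) before
  last-before-vanishes rewrite >⇒≤ᵇ≡false {suc n} {i} (s≤s i≤n) = +-identityʳ _
  after-suc : ∀ j → after (suc j) ≡ ⟦ i ≤ᵇ j ⟧ * f (inside ∷ D j)
  after-suc j with i ≤? j
  ... | yes i≤j rewrite ≤⇒≤ᵇ≡true i≤j | >⇒≤ᵇ≡false (s≤s i≤j) = refl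
  ... | no i≰j rewrite >⇒≤ᵇ≡false (≰⇒> i≰j) | ≤⇒≤ᵇ≡true (≰⇒> i≰j) = refl

-- Step j of D occurs without coordinate 0 for the n + 1 − j insertion points i ≥ j,
-- and with it (one step later) for the j + 1 points i ≤ j.
∑∑-insert : ∀ {n} {D : Chain n} → IsMaximalChain D → (f : Subset (suc n) → ℕ) →
            ∑[ i < suc n ] ∑[ j < suc (suc n) ] f (insert i D j) ≡
            ∑[ j < suc n ] (suc (n ∸ ∣ D j ∣) * f (outside ∷ D j) + suc ∣ D j ∣ * f (inside ∷ D j))
∑∑-insert {n} {D} D-max f = begin
  ∑[ i < suc n ] ∑[ j < suc (suc n) ] f (insert i D j)
    ≡⟨ ∑<-cong (suc n) (λ i i<1+n → ∑-insert D f (≤-pred i<1+n)) ⟩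
  ∑[ i < suc n ] ∑< (suc n) (g i)
    ≡⟨ ∑<-comm (suc n) (suc n) g ⟩
  ∑[ j < suc n ] ∑[ i < suc n ] g i j
    ≡⟨ ∑<-cong (suc n) (λ j j<1+n → count-positions j (≤-pred j<1+n)) ⟩
  ∑[ j < suc n ] (suc (n ∸ ∣ D j ∣) * f (outside ∷ D j) + suc ∣ D j ∣ * f (inside ∷ D j)) ∎
  where
  open ≡-Reasoning
  g : ℕ → ℕ → ℕ
  g i j = ⟦ j ≤ᵇ i ⟧ * f (outside ∷ D j) + ⟦ i ≤ᵇ j ⟧ * f (inside ∷ D j)
  count-positions : ∀ j → j ≤ℕ n →
    ∑[ i < suc n ] g i j ≡ suc (n ∸ ∣ D j ∣) * f (outside ∷ D j) + suc ∣ D j ∣ * f (inside ∷ D j)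
  count-positions j j≤n
    rewrite IsMaximalChain⇒∣c∣≡ D-max j≤n
          | ∑<-distrib-+ (suc n) (λ i → ⟦ j ≤ᵇ i ⟧ * f (outside ∷ D j))
                                 (λ i → ⟦ i ≤ᵇ j ⟧ * f (inside ∷ D j))
          | ∑<-*ʳ (suc n) (λ i → ⟦ j ≤ᵇ i ⟧) (f (outside ∷ D j))
          | ∑<-*ʳ (suc n) (λ i → ⟦ i ≤ᵇ j ⟧) (f (inside ∷ D j))
          | count-≥ j (suc n) | count-≤ j (suc n) (s≤s j≤n) | +-∸-assoc 1 j≤n = refl

chainsThrough : ℕ → ℕ → ℕ
chainsThrough n k = k ! * (n ∸ k) !

∑-maximalChains : ∀ n (f : Subset n → ℕ) →
  ∑[ c ← maximalChains n ] ∑[ j < suc n ] f (c j) ≡ ∑[ G ← allSubsets n ] (f G * chainsThrough n ∣ G ∣)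
∑-maximalChains zero f = trans (+-identityʳ _) (sym (trans (+-identityʳ _) (*-identityʳ _)))
∑-maximalChains (suc n) f = begin
  ∑∈ (concatMap insertions (maximalChains n)) onChain
    ≡⟨ ∑∈-concatMap insertions (maximalChains n) onChain ⟩
  ∑[ D ← maximalChains n ] ∑∈ (insertions D) onChain
    ≡⟨ ∑∈-cong (maximalChains n) (λ {D} D∈ → trans (∑∈-applyUpTo (λ i → insert i D) (suc n) onChain)
                                              (∑∑-insert (∈-maximalChains⇒isMaximalChain n D∈) f)) ⟩
  ∑[ D ← maximalChains n ] ∑[ j < suc n ] f′ (D j)
    ≡⟨ ∑-maximalChains n f′ ⟩
  ∑[ p ← allSubsets n ] (f′ p * chainsThrough n ∣ p ∣)
    ≡⟨ ∑∈-cong (allSubsets n) (λ {p} _ → split p) ⟩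
  ∑[ p ← allSubsets n ] (weighted (inside ∷ p) + weighted (outside ∷ p))
    ≡⟨ ∑∈-distrib-+ (allSubsets n) (weighted ∘ (inside ∷_)) (weighted ∘ (outside ∷_)) ⟩
  ∑[ p ← allSubsets n ] weighted (inside ∷ p) + ∑[ p ← allSubsets n ] weighted (outside ∷ p)
    ≡⟨ cong₂ _+_ (∑∈-map (inside ∷_) (allSubsets n) weighted)
                 (∑∈-map (outside ∷_) (allSubsets n) weighted) ⟨
  ∑∈ (map (inside ∷_) (allSubsets n)) weighted + ∑∈ (map (outside ∷_) (allSubsets n)) weighted
    ≡⟨ ∑∈-++ (map (inside ∷_) (allSubsets n)) (map (outside ∷_) (allSubsets n)) weighted ⟨
  ∑∈ (allSubsets (suc n)) weighted ∎
  where
  open ≡-Reasoning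
  onChain : Chain (suc n) → ℕ
  onChain c = ∑[ j < suc (suc n) ] f (c j)
  f′ : Subset n → ℕ
  f′ p = suc (n ∸ ∣ p ∣) * f (outside ∷ p) + suc ∣ p ∣ * f (inside ∷ p)
  weighted : Subset (suc n) → ℕ
  weighted G = f G * chainsThrough (suc n) ∣ G ∣
  split : ∀ p → f′ p * chainsThrough n ∣ p ∣ ≡ weighted (inside ∷ p) + weighted (outside ∷ p)
  split p rewrite +-∸-assoc 1 (∣p∣≤n p) =
    regroup (f (outside ∷ p)) (f (inside ∷ p)) (n ∸ ∣ p ∣) ∣ p ∣ (∣ p ∣ !) ((n ∸ ∣ p ∣) !)
    where
    regroup : ∀ a b s k K S → (suc s * a + suc k * b) * (K * S) ≡ b * ((suc k * K) * S) + a * (K * (suc s * S))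
    regroup = solve-∀

∑-maximalChains-1 : ∀ n → ∑[ _ ← maximalChains n ] 1 ≡ n !
∑-maximalChains-1 zero = refl
∑-maximalChains-1 (suc n) = begin
  ∑∈ (concatMap insertions (maximalChains n)) (λ _ → 1)
    ≡⟨ ∑∈-concatMap insertions (maximalChains n) (λ _ → 1) ⟩
  ∑[ D ← maximalChains n ] ∑∈ (insertions D) (λ _ → 1)
    ≡⟨ ∑∈-cong (maximalChains n) (λ _ → ∑-insertions-1) ⟩
  ∑[ _ ← maximalChains n ] suc n       ≡⟨ ∑∈-const (maximalChains n) (suc n) ⟩
  ∑[ _ ← maximalChains n ] 1 * suc n   ≡⟨ cong (_* suc n) (∑-maximalChains-1 n) ⟩
  n ! * suc n                          ≡⟨ *-comm (n !) (suc n) ⟩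
  suc n !                              ∎
  where
  open ≡-Reasoning
  ∑<-1 : ∀ m → ∑[ _ < m ] 1 ≡ m
  ∑<-1 zero = refl
  ∑<-1 (suc m) rewrite ∑<-1 m = +-comm m 1
  ∑-insertions-1 : ∀ {D : Chain n} → ∑∈ (insertions D) (λ _ → 1) ≡ suc n
  ∑-insertions-1 {D} = trans (∑∈-applyUpTo (λ i → insert i D) (suc n) (λ _ → 1)) (∑<-1 (suc n))

∣p△p∣≡0 : ∀ {n} (p : Subset n) → ∣ p △ p ∣ ≡ 0
∣p△p∣≡0 [] = refl
∣p△p∣≡0 (inside ∷ p) = ∣p△p∣≡0 p
∣p△p∣≡0 (outside ∷ p) = ∣p△p∣≡0 p

⋖⇒∣△∣≡1 : ∀ {n} {G H : Subset n} → G ⋖ H → ∣ G △ H ∣ ≡ 1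
⋖⇒∣△∣≡1 (⋖-head {p = p}) = cong suc (∣p△p∣≡0 p)
⋖⇒∣△∣≡1 (⋖-tail {b = inside} G⋖H) = ⋖⇒∣△∣≡1 G⋖H
⋖⇒∣△∣≡1 (⋖-tail {b = outside} G⋖H) = ⋖⇒∣△∣≡1 G⋖H

∈-allSubsets : ∀ {n} (G : Subset n) → G ∈ allSubsets n
∈-allSubsets [] = here refl
∈-allSubsets {suc n} (inside ∷ p) = ∈-++⁺ˡ (∈-map⁺ (inside ∷_) (∈-allSubsets p))
∈-allSubsets {suc n} (outside ∷ p) =
  ∈-++⁺ʳ (map (inside ∷_) (allSubsets n)) (∈-map⁺ (outside ∷_) (∈-allSubsets p))

exit⇒∈boundary : ∀ {n} (𝓕 : Family n) {G H} → G ⋖ H →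
                 𝓕 G ≡ true → 𝓕 H ≡ false → boundary 𝓕 H ≡ true
exit⇒∈boundary {n} 𝓕 {G} {H} G⋖H G∈𝓕 H∉𝓕 rewrite H∉𝓕 =
  Equivalence.to T-≡ (any⁺ _ (lose (∈-allSubsets G) G-witnesses))
  where
  G-witnesses : T (𝓕 G ∧ (∣ G △ H ∣ ≡ᵇ 1))
  G-witnesses rewrite G∈𝓕 | ⋖⇒∣△∣≡1 G⋖H = tt

exit-step : (t : ℕ → Bool) {a b : ℕ} → a ≤ℕ b → t a ≡ true → t b ≡ false →
            ∃ λ j → a ≤ℕ j × j <ℕ b × t j ≡ true × t (suc j) ≡ false
exit-step t {a} {zero} z≤n ta tb = contradiction tb (true≢false ta)
exit-step t {a} {suc b} a≤1+b ta tb with m≤n⇒m<n∨m≡n a≤1+b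
... | inj₂ refl = contradiction tb (true≢false ta)
... | inj₁ a<1+b with t b in tb′
...   | true = b , ≤-pred a<1+b , ≤-refl , tb′ , tb
...   | false with j , a≤j , j<b , tj , t1+j ← exit-step t (≤-pred a<1+b) ta tb′ =
  j , a≤j , m<n⇒m<1+n j<b , tj , t1+j

meets : ∀ {n} → Family n → Chain n → ℕ
meets {n} 𝓑 c = count (suc n) (𝓑 ∘ c)

module _ {n} (𝓕 : Family n) {c : Chain n} (c-max : IsMaximalChain c) where

  meets-boundary-between : ∀ {a b} → a ≤ℕ b → b ≤ℕ n → 𝓕 (c a) ≡ true → 𝓕 (c b) ≡ false →
                           ∃ λ j → a ≤ℕ j × j <ℕ b × boundary 𝓕 (c (suc j)) ≡ true
  meets-boundary-between a≤b b≤n ca cb with j , a≤j , j<b , cj , c1+j ← exit-step (𝓕 ∘ c) a≤b ca cb =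
    j , a≤j , j<b , exit⇒∈boundary 𝓕 (covers c-max (≤-trans j<b b≤n)) cj c1+j

  meets-boundary : 𝓕 ⊥ ≡ true → 𝓕 ⊤ ≡ false → 1 ≤ℕ meets (boundary 𝓕) c
  meets-boundary ⊥∈𝓕 ⊤∉𝓕
    with j , _ , j<n , j+1∈∂ ← meets-boundary-between z≤n ≤-refl
                                 (trans (cong 𝓕 (starts-empty c-max)) ⊥∈𝓕)
                                 (trans (cong 𝓕 (ends-full c-max)) ⊤∉𝓕)
    = count-≥1 (suc n) (boundary 𝓕 ∘ c) (s≤s j<n) j+1∈∂

-- n! ‖𝓑‖ₙ, since n! / C(n, k) = k! (n − k)!.
scaledNorm : ∀ {n} → Family n → ℕ
scaledNorm {n} 𝓑 = ∑[ G ← allSubsets n ] (⟦ 𝓑 G ⟧ * chainsThrough n ∣ G ∣)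

module _ {n} (𝓑 : Family n) (meets-every : ∀ {c} → c ∈ maximalChains n → 1 ≤ℕ meets 𝓑 c) where

  private
    ∑-meets≡scaledNorm : ∑[ c ← maximalChains n ] meets 𝓑 c ≡ scaledNorm 𝓑
    ∑-meets≡scaledNorm = ∑-maximalChains n (⟦_⟧ ∘ 𝓑)

  n!≤scaledNorm : n ! ≤ℕ scaledNorm 𝓑
  n!≤scaledNorm = subst₂ _≤ℕ_ (∑-maximalChains-1 n) ∑-meets≡scaledNorm
                         (∑∈-mono-≤ (maximalChains n) meets-every)

  n!<scaledNorm : ∀ {c} → c ∈ maximalChains n → 2 ≤ℕ meets 𝓑 c → n ! <ℕ scaledNorm 𝓑
  n!<scaledNorm c∈ meets-twice = subst₂ _<ℕ_ (∑-maximalChains-1 n) ∑-meets≡scaledNorm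
                                        (∑∈-mono-< (maximalChains n) meets-every c∈ meets-twice)

DownClosed : ∀ {n} → Family n → Set
DownClosed 𝓕 = ∀ {G H} → G ⋖ H → 𝓕 H ≡ true → 𝓕 G ≡ true

ExchangeClosed : ∀ {n} → Family n → Set
ExchangeClosed 𝓕 = ∀ {D G G′ U} → D ⋖ G → D ⋖ G′ → G ⋖ U → G′ ⋖ U →
                   𝓕 G ≡ true → 𝓕 G′ ≡ true

Ball : ∀ {n} → Family n → Set
Ball {n} 𝓕 = Σ ℕ (λ j → (j <ℕ n) × ((G : Subset n) → 𝓕 G ≡ (∣ G ∣ ≤ᵇ j)))

exchangeClosed-∷ : ∀ {n} {𝓕 : Family (suc n)} → ExchangeClosed 𝓕 →
                   ∀ b → ExchangeClosed (𝓕 ∘ (b ∷_))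
exchangeClosed-∷ closed b D⋖G D⋖G′ G⋖U G′⋖U =
  closed (⋖-tail D⋖G) (⋖-tail D⋖G′) (⋖-tail G⋖U) (⋖-tail G′⋖U)

exchangeClosed⇒≡ : ∀ {n} {𝓕 : Family n} → ExchangeClosed 𝓕 →
                   ∀ {D G G′ U} → D ⋖ G → D ⋖ G′ → G ⋖ U → G′ ⋖ U → 𝓕 G ≡ 𝓕 G′
exchangeClosed⇒≡ {𝓕 = 𝓕} closed {G = G} {G′} D⋖G D⋖G′ G⋖U G′⋖U
  with 𝓕 G in G∈? | 𝓕 G′ in G′∈?
... | true | true = refl
... | false | false = refl
... | true | false = ⊥-elim (true≢false (closed D⋖G D⋖G′ G⋖U G′⋖U G∈?) G′∈?)
... | false | true = ⊥-elim (true≢false (closed D⋖G′ D⋖G G′⋖U G⋖U G′∈?) G∈?)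

⋖-extend : ∀ {n} (p : Subset n) → ∣ p ∣ <ℕ n → ∃ (p ⋖_)
⋖-extend (outside ∷ p) _ = inside ∷ p , ⋖-head
⋖-extend (inside ∷ p) ∣p∣<n with q , p⋖q ← ⋖-extend p (≤-pred ∣p∣<n) = inside ∷ q , ⋖-tail p⋖q

exchangeClosed⇒levelConstant : ∀ {n} {𝓕 : Family n} → ExchangeClosed 𝓕 →
                               ∀ G G′ → ∣ G ∣ ≡ ∣ G′ ∣ → 𝓕 G ≡ 𝓕 G′
inside≡outside : ∀ {n} {𝓕 : Family (suc n)} → ExchangeClosed 𝓕 →
                 ∀ p q → suc ∣ p ∣ ≡ ∣ q ∣ → 𝓕 (inside ∷ p) ≡ 𝓕 (outside ∷ q)

exchangeClosed⇒levelConstant closed [] [] _ = refl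
exchangeClosed⇒levelConstant closed (outside ∷ p) (outside ∷ q) ∣p∣≡∣q∣ =
  exchangeClosed⇒levelConstant (exchangeClosed-∷ closed outside) p q ∣p∣≡∣q∣
exchangeClosed⇒levelConstant closed (inside ∷ p) (inside ∷ q) 1+∣p∣≡1+∣q∣ =
  exchangeClosed⇒levelConstant (exchangeClosed-∷ closed inside) p q (suc-injective 1+∣p∣≡1+∣q∣)
exchangeClosed⇒levelConstant closed (inside ∷ p) (outside ∷ q) 1+∣p∣≡∣q∣ =
  inside≡outside closed p q 1+∣p∣≡∣q∣
exchangeClosed⇒levelConstant closed (outside ∷ q) (inside ∷ p) ∣q∣≡1+∣p∣ =
  sym (inside≡outside closed p q (sym ∣q∣≡1+∣p∣))

-- Exchange the head bit through the square over outside ∷ p, landing on a set of the same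
-- size as outside ∷ q; the rest happens in the tail.
inside≡outside {n} closed p q 1+∣p∣≡∣q∣
  with q′ , p⋖q′ ← ⋖-extend p (subst (_≤ℕ n) (sym 1+∣p∣≡∣q∣) (∣p∣≤n q)) =
  trans (exchangeClosed⇒≡ closed ⋖-head (⋖-tail p⋖q′) (⋖-tail p⋖q′) ⋖-head)
        (exchangeClosed⇒levelConstant (exchangeClosed-∷ closed outside) q′ q
                                      (trans (⋖⇒∣∣≡suc p⋖q′) 1+∣p∣≡∣q∣))

downClosed-along : ∀ {n} {𝓕 : Family n} → DownClosed 𝓕 → ∀ {c} → IsMaximalChain c →
                   ∀ {k m} → k ≤ℕ m → m ≤ℕ n → 𝓕 (c m) ≡ true → 𝓕 (c k) ≡ true
downClosed-along down c-max {m = zero} z≤n _ c0∈𝓕 = c0∈𝓕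
downClosed-along down c-max {k} {suc m} k≤1+m 1+m≤n c1+m∈𝓕 with m≤n⇒m<n∨m≡n k≤1+m
... | inj₂ refl = c1+m∈𝓕
... | inj₁ k<1+m =
  downClosed-along down c-max (≤-pred k<1+m) (<⇒≤ 1+m≤n) (down (covers c-max 1+m≤n) c1+m∈𝓕)

downClosed⇒threshold-on-chain : ∀ {n} {𝓕 : Family n} → DownClosed 𝓕 → ∀ {c} → IsMaximalChain c →
                                ∀ {j} → j <ℕ n → 𝓕 (c j) ≡ true → 𝓕 (c (suc j)) ≡ false →
                                ∀ {k} → k ≤ℕ n → 𝓕 (c k) ≡ (k ≤ᵇ j)
downClosed⇒threshold-on-chain {𝓕 = 𝓕} down {c} c-max {j} j<n cj∈𝓕 c1+j∉𝓕 {k} k≤n with k ≤? j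
... | yes k≤j rewrite ≤⇒≤ᵇ≡true k≤j = downClosed-along down c-max k≤j (<⇒≤ j<n) cj∈𝓕
... | no k≰j with 𝓕 (c k) in ck∈𝓕?
...   | true = ⊥-elim (true≢false (downClosed-along down c-max (≰⇒> k≰j) k≤n ck∈𝓕?) c1+j∉𝓕)
...   | false = sym (>⇒≤ᵇ≡false (≰⇒> k≰j))

downClosed∧exchangeClosed⇒ball : ∀ {n} {𝓕 : Family n} → DownClosed 𝓕 → ExchangeClosed 𝓕 →
                                 𝓕 ⊥ ≡ true → 𝓕 ⊤ ≡ false → Ball 𝓕
downClosed∧exchangeClosed⇒ball {n} {𝓕} down closed ⊥∈𝓕 ⊤∉𝓕
  with c , c∈ , _ ← chain-through n ⊥
  with c-max ← ∈-maximalChains⇒isMaximalChain n c∈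
  with j , _ , j<n , cj∈𝓕 , c1+j∉𝓕 ← exit-step (𝓕 ∘ c) z≤n
                                        (trans (cong 𝓕 (starts-empty c-max)) ⊥∈𝓕)
                                        (trans (cong 𝓕 (ends-full c-max)) ⊤∉𝓕)
  = j , j<n , λ G →
    trans (exchangeClosed⇒levelConstant closed G (c ∣ G ∣)
                                        (sym (IsMaximalChain⇒∣c∣≡ c-max (∣p∣≤n G))))
          (downClosed⇒threshold-on-chain down c-max j<n cj∈𝓕 c1+j∉𝓕 (∣p∣≤n G))

module _ {n} (𝓕 : Family n) (⊥∈𝓕 : 𝓕 ⊥ ≡ true) (⊤∉𝓕 : 𝓕 ⊤ ≡ false)
         (meets-once : ∀ {c} → c ∈ maximalChains n → meets (boundary 𝓕) c ≤ℕ 1) where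

  private
    no-two-meets : ∀ {c} → c ∈ maximalChains n → ∀ {k l} → k <ℕ l → l ≤ℕ n →
                   boundary 𝓕 (c k) ≡ true → boundary 𝓕 (c l) ≡ true → Empty
    no-two-meets {c} c∈ k<l l≤n k∈∂ l∈∂ =
      <⇒≱ (count-≥2 (suc n) (boundary 𝓕 ∘ c) k<l (s≤s l≤n) k∈∂ l∈∂) (meets-once c∈)

  meets-once⇒downClosed : DownClosed 𝓕
  meets-once⇒downClosed {G} {H} G⋖H H∈𝓕 with 𝓕 G in G∈𝓕?
  ... | true = refl
  ... | false
    with c , c∈ , cG , cH ← chain-through-⋖ G⋖H
    with c-max ← ∈-maximalChains⇒isMaximalChain n c∈
    with j , _ , j<∣G∣ , 1+j∈∂ ← meets-boundary-between 𝓕 c-max z≤n (<⇒≤ (⋖⇒∣∣<n G⋖H))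
                                   (trans (cong 𝓕 (starts-empty c-max)) ⊥∈𝓕) (trans (cong 𝓕 cG) G∈𝓕?)
    with l , ∣G∣<l , l<n , 1+l∈∂ ← meets-boundary-between 𝓕 c-max (⋖⇒∣∣<n G⋖H) ≤-refl
                                     (trans (cong 𝓕 cH) H∈𝓕) (trans (cong 𝓕 (ends-full c-max)) ⊤∉𝓕)
    = ⊥-elim (no-two-meets c∈ (s≤s (<-trans j<∣G∣ ∣G∣<l)) l<n 1+j∈∂ 1+l∈∂)

  meets-once⇒exchangeClosed : ExchangeClosed 𝓕
  meets-once⇒exchangeClosed {D} {G} {G′} {U} D⋖G D⋖G′ G⋖U G′⋖U G∈𝓕 with 𝓕 G′ in G′∈𝓕?
  ... | true = refl
  ... | false with 𝓕 U in U∈𝓕?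
  ...   | true = ⊥-elim (true≢false (meets-once⇒downClosed G′⋖U U∈𝓕?) G′∈𝓕?)
  ...   | false with c , c∈ , cG′ , cU ← chain-through-⋖ G′⋖U =
    ⊥-elim (no-two-meets c∈ ≤-refl (⋖⇒∣∣<n G′⋖U)
             (subst (λ X → boundary 𝓕 X ≡ true) (sym cG′)
                    (exit⇒∈boundary 𝓕 D⋖G′ (meets-once⇒downClosed D⋖G G∈𝓕) G′∈𝓕?))
             (subst (λ X → boundary 𝓕 X ≡ true) (sym cU) (exit⇒∈boundary 𝓕 G⋖U G∈𝓕 U∈𝓕?)))

  meets-once⇒ball : Ball 𝓕
  meets-once⇒ball =
    downClosed∧exchangeClosed⇒ball meets-once⇒downClosed meets-once⇒exchangeClosed ⊥∈𝓕 ⊤∉𝓕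

⌜_⌝ : ℕ → ℚᵘ
⌜ a ⌝ = mkℚᵘ (ℤ.+ a) 0

⌜⌝-homo-+ : ∀ a b → ⌜ a ⌝ ℚᵘ.+ ⌜ b ⌝ ℚᵘ.≃ ⌜ a + b ⌝
⌜⌝-homo-+ a b = *≡* (trans (regroup (ℤ.+ a) (ℤ.+ b)) (cong (ℤ._* 1ℤ) (sym (ℤ.pos-+ a b))))
  where
  regroup : ∀ x y → (x ℤ.* 1ℤ ℤ.+ y ℤ.* 1ℤ) ℤ.* 1ℤ ≡ (x ℤ.+ y) ℤ.* 1ℤ
  regroup = ℤ-solve-∀

⌜⌝-mono-≤ : ∀ {a b} → a ≤ℕ b → ⌜ a ⌝ ℚᵘ.≤ ⌜ b ⌝
⌜⌝-mono-≤ {a} {b} a≤b =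
  *≤* (subst₂ ℤ._≤_ (sym (ℤ.*-identityʳ (ℤ.+ a))) (sym (ℤ.*-identityʳ (ℤ.+ b))) (ℤ.+≤+ a≤b))

⌜⌝-mono-< : ∀ {a b} → a <ℕ b → ⌜ a ⌝ ℚᵘ.< ⌜ b ⌝
⌜⌝-mono-< {a} {b} a<b =
  *<* (subst₂ ℤ._<_ (sym (ℤ.*-identityʳ (ℤ.+ a))) (sym (ℤ.*-identityʳ (ℤ.+ b))) (ℤ.+<+ a<b))

recip-*-⌜⌝ : ∀ c w {N} → c * w ≡ N → 0 <ℕ N → toℚᵘ (recip c) ℚᵘ.* ⌜ N ⌝ ℚᵘ.≃ ⌜ w ⌝
recip-*-⌜⌝ (suc c) w refl _ =
  ℚᵘ.≃-trans (ℚᵘ.*-congʳ (toℚᵘ-fromℚᵘ (mkℚᵘ 1ℤ c)))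
    (*≡* (trans (cong (λ z → (1ℤ ℤ.* z) ℤ.* 1ℤ) (ℤ.pos-* (suc c) w))
         (trans (regroup (ℤ.+ suc c) (ℤ.+ w)) (cong (ℤ.+ w ℤ.*_) (sym (ℤ.pos-* (suc c) 1))))))
  where
  regroup : ∀ x y → (1ℤ ℤ.* (x ℤ.* y)) ℤ.* 1ℤ ≡ y ℤ.* (x ℤ.* 1ℤ)
  regroup = ℤ-solve-∀

nCk*chainsThrough≡n! : ∀ n k → k ≤ℕ n → (n C k) * chainsThrough n k ≡ n !
nCk*chainsThrough≡n! n k k≤n =
  trans (cong (_* chainsThrough n k) (nCk≡n!/k![n-k]! k≤n))
        (m/n*n≡m {{k !* (n ∸ k) !≢0}} (k![n∸k]!∣n! k≤n))

norm-*-n! : ∀ {n} (𝓑 : Family n) → toℚᵘ (norm 𝓑) ℚᵘ.* ⌜ n ! ⌝ ℚᵘ.≃ ⌜ scaledNorm 𝓑 ⌝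
norm-*-n! {n} 𝓑 = go (allSubsets n)
  where
  term : Subset n → ℚ
  term G = if 𝓑 G then recip (n C ∣ G ∣) else 0ℚ
  weight : Subset n → ℕ
  weight G = ⟦ 𝓑 G ⟧ * chainsThrough n ∣ G ∣
  term-*-n! : ∀ G → toℚᵘ (term G) ℚᵘ.* ⌜ n ! ⌝ ℚᵘ.≃ ⌜ weight G ⌝
  term-*-n! G with 𝓑 G
  ... | false = ℚᵘ.*-zeroˡ ⌜ n ! ⌝
  ... | true rewrite +-identityʳ (chainsThrough n ∣ G ∣) =
    recip-*-⌜⌝ (n C ∣ G ∣) (chainsThrough n ∣ G ∣) (nCk*chainsThrough≡n! n ∣ G ∣ (∣p∣≤n G)) (1≤n! n)
  go : (Gs : List (Subset n)) →
       toℚᵘ (foldr (λ G acc → term G ℚ.+ acc) 0ℚ Gs) ℚᵘ.* ⌜ n ! ⌝ ℚᵘ.≃ ⌜ ∑∈ Gs weight ⌝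
  go [] = ℚᵘ.*-zeroˡ ⌜ n ! ⌝
  go (G ∷ Gs) =
    ℚᵘ.≃-trans (ℚᵘ.*-congʳ (toℚᵘ-homo-+ (term G) _))
    (ℚᵘ.≃-trans (ℚᵘ.*-distribʳ-+ ⌜ n ! ⌝ (toℚᵘ (term G)) _)
    (ℚᵘ.≃-trans (ℚᵘ.+-cong (term-*-n! G) (go Gs))
    (⌜⌝-homo-+ (weight G) (∑∈ Gs weight))))

module _ {n} (𝓑 : Family n) where

  private
    ⌜n!⌝-positive : ℚᵘ.Positive ⌜ n ! ⌝
    ⌜n!⌝-positive = ℚᵘ.positive (⌜⌝-mono-< (1≤n! n))

  n!≤scaledNorm⇒1≤norm : n ! ≤ℕ scaledNorm 𝓑 → 1ℚ ≤ norm 𝓑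
  n!≤scaledNorm⇒1≤norm n!≤ = toℚᵘ-cancel-≤ (ℚᵘ.*-cancelʳ-≤-pos ⌜ n ! ⌝ {{⌜n!⌝-positive}}
    (ℚᵘ.≤-respʳ-≃ (ℚᵘ.≃-sym (norm-*-n! 𝓑))
      (ℚᵘ.≤-respˡ-≃ (ℚᵘ.≃-sym (ℚᵘ.*-identityˡ _)) (⌜⌝-mono-≤ n!≤))))

  n!<scaledNorm⇒1<norm : n ! <ℕ scaledNorm 𝓑 → 1ℚ < norm 𝓑
  n!<scaledNorm⇒1<norm n!< = toℚᵘ-cancel-< (ℚᵘ.*-cancelʳ-<-nonNeg ⌜ n ! ⌝
    (ℚᵘ.<-respʳ-≃ (ℚᵘ.≃-sym (norm-*-n! 𝓑))
      (ℚᵘ.<-respˡ-≃ (ℚᵘ.≃-sym (ℚᵘ.*-identityˡ _)) (⌜⌝-mono-< n!<))))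

theorem3p1 : (n : ℕ) → 1 ≤ℕ n → (𝓕 : Family n) → 𝓕 ⊥ ≡ true → 𝓕 ⊤ ≡ false →
    (1ℚ ≤ norm (boundary 𝓕)) ×
    (¬ (Σ ℕ (λ j → (j <ℕ n) × ((G : Subset n) → 𝓕 G ≡ (∣ G ∣ ≤ᵇ j)))) → 1ℚ < norm (boundary 𝓕))
theorem3p1 n _ 𝓕 ⊥∈𝓕 ⊤∉𝓕 = n!≤scaledNorm⇒1≤norm ∂𝓕 (n!≤scaledNorm ∂𝓕 meets-every) , strict
  where
  ∂𝓕 : Family n
  ∂𝓕 = boundary 𝓕
  meets-every : ∀ {c} → c ∈ maximalChains n → 1 ≤ℕ meets ∂𝓕 c
  meets-every c∈ = meets-boundary 𝓕 (∈-maximalChains⇒isMaximalChain n c∈) ⊥∈𝓕 ⊤∉𝓕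
  strict : ¬ Ball 𝓕 → 1ℚ < norm ∂𝓕
  strict ¬ball with all? (λ c → meets ∂𝓕 c ≤? 1) (maximalChains n)
  ... | yes meet-once = contradiction (meets-once⇒ball 𝓕 ⊥∈𝓕 ⊤∉𝓕 (All.lookup meet-once)) ¬ball
  ... | no ¬meet-once
    with c , c∈ , c-meets≰1 ← find (¬All⇒Any¬ (λ c → meets ∂𝓕 c ≤? 1) _ ¬meet-once) =
    n!<scaledNorm⇒1<norm ∂𝓕 (n!<scaledNorm ∂𝓕 meets-every c∈ (≰⇒> c-meets≰1))
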